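{- Let $D=(F,T)\in\mathcal D_k$ and let $H$ be a graph. Then $$\hom(D,H)=\sum_{G\sqsubseteq_{\mathrm{col}} D}\mathrm{s\text{ - }epi}(D,G)\cdot \mathrm{pi\text{ - }hom}\big((G,T[V(G)]),H\big),$$ where the sum ranges over all graphs $G$ with $G\sqsubseteq_{\mathrm{col}} D$ (terms with $\mathrm{s\text{ - }epi}(D,G)=0$ contribute $0$).
   Context: Graphs are finite, undirected, vertex-coloured triples $(V(G),E(G),\gamma^G)$. A homomorphism preserves edges and colours; $\hom(F,H)$ counts homomorphisms. An epimorphism $h:F\to G$ is a surjective homomorphism such that every edge of $G$ is the image of an edge of $F$. A tree is a finite poset $(V(T),\preceq)$ with a unique minimal element in which each $\{u:u\preceq t\}$ is a chain; height = maximum size of a chain. For $U\subseteq V(T)$, $T[U]$ is the restriction of the order to $U$. An elimination tree of a graph $F$ is a tree on $V(F)$ with $u\preceq v$ or $v\preceq u$ for every edge $uv$. $\mathcal D_k$ is the class of pairs $D=(F,T)$ with $F$ a graph and $T$ an elimination tree of $F$ of height at most $k$; $\preceq^D=\preceq^T$, $V(D)=V(F)$; $\hom(D,H):=\hom(F,H)$. A homomorphism $g:(G,T')\to H$ is past-injective if $g(u)\ne g(v)$ whenever $u$ strictly precedes $v$ in $T'$; $\mathrm{pi\text{ - }hom}$ counts these. $G\sqsubseteq_{\mathrm{col}} D$ means $V(G)\subseteq V(F)$ and $\gamma^G=\gamma^F$ on $V(G)$. A shrinking epimorphism from $D$ to a graph $G$ with $V(G)\subseteq V(D)$ is an epimorphism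 $f:F\to G$ with $f(u)\preceq^D u$ and $f(f(u))=f(u)$ for all $u$; $\mathrm{s\text{ - }epi}(D,G)$ is the number of shrinking epimorphisms from $D$ to $G$. -}

module Defs where

open import Data.Nat using (ℕ; zero; suc; _≤_)
open import Data.Bool using (Bool; true; false)
open import Data.Bool.Properties using () renaming (_≟_ to _≟B_)
open import Data.Fin using (Fin; _≟_)
open import Data.Fin.Properties using (all?; any?)
open import Data.Maybe using (Maybe; just; nothing)
open import Data.Maybe.Properties using (≡-dec)
open import Data.List using (List; []; _∷_; map; concatMap; length; filter; sum; allFin)
open import Data.List.Relation.Unary.Unique.Propositional using (Unique)
open import Data.List.Relation.Unary.AllPairs using (AllPairs)
open import Data.Vec.Functional using () renaming (_∷_ to _∷ᶠ_)
open import Data.Product using (Σ; ∃; _×_; _,_)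
open import Data.Sum using (_⊎_)
open import Relation.Binary.PropositionalEquality using (_≡_; _≢_)
open import Relation.Nullary using (Dec; ¬_)
open import Relation.Nullary.Decidable using (_×-dec_; _→-dec_; _⊎-dec_; ¬?)
open import Relation.Unary using (Pred; Decidable)
import Agda.Primitive

funs : {A : Set} (n : ℕ) → List A → List (Fin n → A)
funs zero    xs = (λ ()) ∷ []
funs (suc n) xs = concatMap (λ x → map (λ g → x ∷ᶠ g) (funs n xs)) xs

bools : List Bool
bools = false ∷ true ∷ []

count : {A : Set} {P : Pred A Agda.Primitive.lzero} → Decidable P → List A → ℕ
count P? xs = length (filter P? xs)

record Graph : Set where
  field
    size   : ℕ
    col    : Fin size → ℕ
    adj    : Fin size → Fin size → Bool
    sym    : ∀ u v → adj u v ≡ adj v u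
    irrefl : ∀ u → adj u u ≡ false
open Graph public

Edge : (G : Graph) → Fin (size G) → Fin (size G) → Set
Edge G u v = adj G u v ≡ true

IsHom : (F H : Graph) → (Fin (size F) → Fin (size H)) → Set
IsHom F H h = (∀ u → col H (h u) ≡ col F u)
            × (∀ u v → Edge F u v → Edge H (h u) (h v))

isHom? : (F H : Graph) → Decidable (IsHom F H)
isHom? F H h = all? (λ u → Data.Nat._≟_ (col H (h u)) (col F u))
        ×-dec all? (λ u → all? (λ v → (adj F u v ≟B true) →-dec (adj H (h u) (h v) ≟B true)))

hom : Graph → Graph → ℕ
hom F H = count (isHom? F H) (funs (size F) (allFin (size H)))

module _ {n : ℕ} (le : Fin n → Fin n → Bool) where

  _≼_ : Fin n → Fin n → Set
  u ≼ v = le u v ≡ true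

  _≺_ : Fin n → Fin n → Set
  u ≺ v = (u ≼ v) × (u ≢ v)

  Minimal : Fin n → Set
  Minimal r = ∀ v → v ≼ r → v ≡ r

  Comparable : Fin n → Fin n → Set
  Comparable u v = (u ≼ v) ⊎ (v ≼ u)

  record IsTree : Set where
    field
      refl     : ∀ u → u ≼ u
      antisym  : ∀ u v → u ≼ v → v ≼ u → u ≡ v
      trans    : ∀ u v w → u ≼ v → v ≼ w → u ≼ w
      root     : Σ (Fin n) λ r → Minimal r × (∀ r′ → Minimal r′ → r′ ≡ r)
      downChain : ∀ t u v → u ≼ t → v ≼ t → Comparable u v

  HeightAtMost : ℕ → Set
  HeightAtMost k = ∀ (c : List (Fin n)) → Unique c → AllPairs Comparable c → length c ≤ k

record IsEliminationTree (k : ℕ) (F : Graph) (le : Fin (size F) → Fin (size F) → Bool) : Set where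
  field
    tree      : IsTree le
    height    : HeightAtMost le k
    edgesComp : ∀ u v → Edge F u v → Comparable le u v

-- Graphs G with G ⊑_col D, for D = (F , T).
-- Such G is given by its vertex set S ⊆ V(F) and its edge relation E on S;
-- colours are inherited from F (γ^G = γ^F on V(G)).

module _ (F : Graph) where
  private n = size F

  IsColSub : (Fin n → Bool) × (Fin n → Fin n → Bool) → Set
  IsColSub (S , E) = (∀ u v → E u v ≡ true → S u ≡ true)
                   × (∀ u v → E u v ≡ E v u)
                   × (∀ u → E u u ≡ false)

  isColSub? : Decidable IsColSub
  isColSub? (S , E) =
        all? (λ u → all? (λ v → (E u v ≟B true) →-dec (S u ≟B true)))
    ×-dec all? (λ u → all? (λ v → E u v ≟B E v u))
    ×-dec all? (λ u → E u u ≟B false)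

  candidates : List ((Fin n → Bool) × (Fin n → Fin n → Bool))
  candidates = concatMap (λ S → map (λ E → (S , E)) (funs n (funs n bools))) (funs n bools)

  colSubs : List ((Fin n → Bool) × (Fin n → Fin n → Bool))
  colSubs = filter isColSub? candidates

  module _ (le : Fin n → Fin n → Bool) where

    IsShrinkingEpi : (Fin n → Bool) × (Fin n → Fin n → Bool) → (Fin n → Fin n) → Set
    IsShrinkingEpi (S , E) f =
        (∀ u → S (f u) ≡ true)
      × (∀ u → col F (f u) ≡ col F u)
      × (∀ u v → Edge F u v → E (f u) (f v) ≡ true)
      × (∀ w → S w ≡ true → ∃ λ u → f u ≡ w)
      × (∀ w w′ → E w w′ ≡ true → ∃ λ u → ∃ λ v → Edge F u v × f u ≡ w × f v ≡ w′)
      × (∀ u → _≼_ le (f u) u)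
      × (∀ u → f (f u) ≡ f u)

    isShrinkingEpi? : (G : (Fin n → Bool) × (Fin n → Fin n → Bool)) → Decidable (IsShrinkingEpi G)
    isShrinkingEpi? (S , E) f =
            all? (λ u → S (f u) ≟B true)
      ×-dec all? (λ u → Data.Nat._≟_ (col F (f u)) (col F u))
      ×-dec all? (λ u → all? (λ v → (adj F u v ≟B true) →-dec (E (f u) (f v) ≟B true)))
      ×-dec all? (λ w → (S w ≟B true) →-dec any? (λ u → f u ≟ w))
      ×-dec all? (λ w → all? (λ w′ → (E w w′ ≟B true) →-dec
               any? (λ u → any? (λ v → (adj F u v ≟B true) ×-dec (f u ≟ w) ×-dec (f v ≟ w′)))))
      ×-dec all? (λ u → le (f u) u ≟B true)
      ×-dec all? (λ u → f (f u) ≟ f u)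

    s-epi : (Fin n → Bool) × (Fin n → Fin n → Bool) → ℕ
    s-epi G = count (isShrinkingEpi? G) (funs n (allFin n))

    -- past-injective homomorphisms (G , T[V(G)]) → H.
    -- A map V(G) → V(H) is encoded as g : Fin n → Maybe (Fin m) with
    -- g u ≡ nothing exactly for u ∉ V(G).
    module _ (H : Graph) where
      private m = size H

      IsPIHom : (Fin n → Bool) × (Fin n → Fin n → Bool) → (Fin n → Maybe (Fin m)) → Set
      IsPIHom (S , E) g =
          (∀ u → S u ≡ false → g u ≡ nothing)
        × (∀ u → S u ≡ true → ∃ λ x → g u ≡ just x × col H x ≡ col F u)
        × (∀ u v x y → E u v ≡ true → g u ≡ just x → g v ≡ just y → Edge H x y)
        × (∀ u v → S u ≡ true → S v ≡ true → _≺_ le u v → g u ≢ g v)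

      isPIHom? : (G : (Fin n → Bool) × (Fin n → Fin n → Bool)) → Decidable (IsPIHom G)
      isPIHom? (S , E) g =
              all? (λ u → (S u ≟B false) →-dec ≡-dec _≟_ (g u) nothing)
        ×-dec all? (λ u → (S u ≟B true) →-dec
                 any? (λ x → ≡-dec _≟_ (g u) (just x) ×-dec Data.Nat._≟_ (col H x) (col F u)))
        ×-dec all? (λ u → all? (λ v → all? (λ x → all? (λ y →
                 (E u v ≟B true) →-dec (≡-dec _≟_ (g u) (just x) →-dec
                 (≡-dec _≟_ (g v) (just y) →-dec (adj H x y ≟B true)))))))
        ×-dec all? (λ u → all? (λ v → (S u ≟B true) →-dec ((S v ≟B true) →-dec
                 (((le u v ≟B true) ×-dec ¬? (u ≟ v)) →-dec ¬? (≡-dec _≟_ (g u) (g v))))))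

      pi-hom : (Fin n → Bool) × (Fin n → Fin n → Bool) → ℕ
      pi-hom G = count (isPIHom? G) (funs n (nothing ∷ map just (allFin m)))

-- Both sides count the pairs (h, (G, f, g)) with h = g ∘ f, where f is a shrinking epimorphism
-- from D onto some G ⊑col D and g a past-injective homomorphism from (G, T[V(G)]) to H.  A triple
-- (G, f, g) determines h = g ∘ f, which is a homomorphism F → H.  Conversely a homomorphism h has
-- exactly one such factorisation: past-injectivity of g forces f to send u to its root, the
-- ⊑-least ancestor of u with the same image under h (it exists because the ancestors of u form a
-- chain); then G is the image of F under the root map and g is h restricted to the roots.

module Submission where

open import Defs
open import Data.Nat using (ℕ; _*_)
open import Data.Bool using (Bool)
open import Data.Fin using (Fin)
open import Data.List using (map)
open import Data.Nat.ListAction using (sum)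
open import Relation.Binary.PropositionalEquality using (_≡_)

open import Level using (0ℓ)
open import Data.Nat using (zero; suc; _+_)
open import Data.Nat.Properties using (+-identityʳ; *-identityʳ; *-zeroʳ; *-comm; *-distribˡ-+; +-commutativeSemigroup)
open import Algebra.Properties.CommutativeSemigroup +-commutativeSemigroup using (interchange)
open import Data.Nat.ListAction.Properties using (sum-++)
open import Data.Bool using (true; false; if_then_else_)
open import Data.Bool.Properties using (¬-not) renaming (_≟_ to _≟B_)
open import Data.Fin using (_≟_)
open import Data.Fin.Properties using (all?; any?)
open import Data.Maybe using (Maybe; just; nothing)
open import Data.Maybe.Properties using (just-injective)
import Data.Maybe.Properties as Maybe
open import Data.List using (List; []; _∷_; _++_; concatMap; filter; allFin)
open import Data.List.Properties using (map-cong; map-++; map-∘; map-tabulate)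
open import Data.List.Membership.Propositional using (_∈_)
open import Data.List.Membership.Propositional.Properties using (∈-allFin)
open import Data.List.Relation.Unary.Any using (here; there)
open import Data.Vec.Functional using () renaming (_∷_ to _∷ᶠ_)
open import Data.Vec.Functional.Relation.Binary.Pointwise using () renaming (Pointwise to Pointwiseᵛ)
open import Data.Vec.Functional.Relation.Binary.Pointwise.Properties using () renaming (decidable to Pointwiseᵛ-decidable)
open import Data.Product using (∃; _×_; _,_; proj₁; proj₂)
open import Data.Product.Relation.Binary.Pointwise.NonDependent using (Pointwise; ×-decidable)
open import Data.Sum using (_⊎_; inj₁; inj₂)
open import Function using (_∘_; _⇔_; mk⇔; Equivalence)
open import Relation.Binary using (Rel; Reflexive; Transitive) renaming (Decidable to Decidable₂)
open import Relation.Binary.PropositionalEquality using (_≢_; refl; trans; cong; cong₂; subst; subst₂; module ≡-Reasoning)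
import Relation.Binary.PropositionalEquality as ≡
open import Relation.Nullary using (Dec; yes; no; does; ¬_; contradiction)
open import Relation.Nullary.Decidable using (_×-dec_; dec-true; dec-false; does-⇔)
open import Relation.Unary using (Pred) renaming (Decidable to Decidable₁)

private
  variable
    A B : Set

-- Indicators and finite sums

𝟙 : Dec A → ℕ
𝟙 a? = if does a? then 1 else 0

𝟙-no : (a? : Dec A) → ¬ A → 𝟙 a? ≡ 0
𝟙-no a? ¬a = cong (λ b → if b then 1 else 0) (dec-false a? ¬a)

𝟙-cong : A ⇔ B → (a? : Dec A) (b? : Dec B) → 𝟙 a? ≡ 𝟙 b?
𝟙-cong A⇔B a? b? = cong (λ b → if b then 1 else 0) (does-⇔ A⇔B a? b?)

𝟙-× : (a? : Dec A) (b? : Dec B) → 𝟙 (a? ×-dec b?) ≡ 𝟙 a? * 𝟙 b?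
𝟙-× (yes _) b? = ≡.sym (+-identityʳ (𝟙 b?))
𝟙-× (no _)  b? = refl

does-true⇒ : (a? : Dec A) → does a? ≡ true → A
does-true⇒ (yes a) _ = a

≡-does : ∀ b (a? : Dec A) → b ≡ true ⇔ A → b ≡ does a?
≡-does true  a? b⇔A = ≡.sym (dec-true a? (Equivalence.to b⇔A refl))
≡-does false a? b⇔A = ≡.sym (dec-false a? (λ a → contradiction (Equivalence.from b⇔A a) (λ ())))

∑ : List A → (A → ℕ) → ℕ
∑ xs w = sum (map w xs)

∑-cong : (xs : List A) {v w : A → ℕ} → (∀ x → v x ≡ w x) → ∑ xs v ≡ ∑ xs w
∑-cong xs v≗w = cong sum (map-cong v≗w xs)

∑-zero : (xs : List A) {w : A → ℕ} → (∀ x → w x ≡ 0) → ∑ xs w ≡ 0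
∑-zero []       w≗0 = refl
∑-zero (x ∷ xs) w≗0 = cong₂ _+_ (w≗0 x) (∑-zero xs w≗0)

∑-++ : (xs ys : List A) (w : A → ℕ) → ∑ (xs ++ ys) w ≡ ∑ xs w + ∑ ys w
∑-++ xs ys w = trans (cong sum (map-++ w xs ys)) (sum-++ (map w xs) (map w ys))

∑-concatMap : (k : A → List B) (xs : List A) (w : B → ℕ) →
              ∑ (concatMap k xs) w ≡ ∑ xs (λ x → ∑ (k x) w)
∑-concatMap k []       w = refl
∑-concatMap k (x ∷ xs) w =
  trans (∑-++ (k x) (concatMap k xs) w) (cong (∑ (k x) w +_) (∑-concatMap k xs w))

∑-map : (f : A → B) (xs : List A) (w : B → ℕ) → ∑ (map f xs) w ≡ ∑ xs (w ∘ f)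
∑-map f xs w = cong sum (≡.sym (map-∘ xs))

*-distribˡ-∑ : (c : ℕ) (xs : List A) (w : A → ℕ) → c * ∑ xs w ≡ ∑ xs (λ x → c * w x)
*-distribˡ-∑ c []       w = *-zeroʳ c
*-distribˡ-∑ c (x ∷ xs) w = trans (*-distribˡ-+ c (w x) _) (cong (c * w x +_) (*-distribˡ-∑ c xs w))

*-distribʳ-∑ : (c : ℕ) (xs : List A) (w : A → ℕ) → ∑ xs w * c ≡ ∑ xs (λ x → w x * c)
*-distribʳ-∑ c xs w =
  trans (*-comm (∑ xs w) c) (trans (*-distribˡ-∑ c xs w) (∑-cong xs (λ x → *-comm c (w x))))

∑-+ : (xs : List A) (v w : A → ℕ) → ∑ xs (λ x → v x + w x) ≡ ∑ xs v + ∑ xs w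
∑-+ []       v w = refl
∑-+ (x ∷ xs) v w = trans (cong (v x + w x +_) (∑-+ xs v w)) (interchange (v x) (w x) _ _)

∑-swap : (xs : List A) (ys : List B) (w : A → B → ℕ) →
         ∑ xs (λ x → ∑ ys (w x)) ≡ ∑ ys (λ y → ∑ xs (λ x → w x y))
∑-swap []       ys w = ≡.sym (∑-zero ys (λ _ → refl))
∑-swap (x ∷ xs) ys w = trans (cong (∑ ys (w x) +_) (∑-swap xs ys w)) (≡.sym (∑-+ ys (w x) _))

count≡∑𝟙 : {P : Pred A 0ℓ} (P? : Decidable₁ P) (xs : List A) → count P? xs ≡ ∑ xs (𝟙 ∘ P?)
count≡∑𝟙 P? []       = refl
count≡∑𝟙 P? (x ∷ xs) with does (P? x)
... | true  = cong suc (count≡∑𝟙 P? xs)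
... | false = count≡∑𝟙 P? xs

∑-filter : {P : Pred A 0ℓ} (P? : Decidable₁ P) (xs : List A) (w : A → ℕ) →
           sum (map w (filter P? xs)) ≡ ∑ xs (λ x → 𝟙 (P? x) * w x)
∑-filter P? []       w = refl
∑-filter P? (x ∷ xs) w with does (P? x)
... | true  = cong₂ _+_ (≡.sym (+-identityʳ (w x))) (∑-filter P? xs w)
... | false = ∑-filter P? xs w

infixr 7 _⊗_
_⊗_ : List A → List B → List (A × B)
xs ⊗ ys = concatMap (λ x → map (x ,_) ys) xs

∑-⊗ : (xs : List A) (ys : List B) (w : A × B → ℕ) →
      ∑ (xs ⊗ ys) w ≡ ∑ xs (λ x → ∑ ys (λ y → w (x , y)))
∑-⊗ xs ys w = trans (∑-concatMap _ xs w) (∑-cong xs (λ x → ∑-map (x ,_) ys w))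

∑-⊗-* : (xs : List A) (ys : List B) (v : A → ℕ) (w : B → ℕ) →
        ∑ (xs ⊗ ys) (λ (x , y) → v x * w y) ≡ ∑ xs v * ∑ ys w
∑-⊗-* xs ys v w = begin
  ∑ (xs ⊗ ys) (λ (x , y) → v x * w y)   ≡⟨ ∑-⊗ xs ys _ ⟩
  ∑ xs (λ x → ∑ ys (λ y → v x * w y))   ≡⟨ ∑-cong xs (λ x → ≡.sym (*-distribˡ-∑ (v x) ys w)) ⟩
  ∑ xs (λ x → v x * ∑ ys w)             ≡⟨ ≡.sym (*-distribʳ-∑ (∑ ys w) xs v) ⟩
  ∑ xs v * ∑ ys w                       ∎
  where open ≡-Reasoning

-- Functions can only be compared pointwise, so enumerations list each element exactly once up to
-- a decidable equivalence rather than up to ≡.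
record EnumeratesOnce {_≈_ : Rel A 0ℓ} (_≈?_ : Decidable₂ _≈_) (xs : List A) : Set where
  field
    exactlyOne : ∀ a → ∑ xs (λ x → 𝟙 (x ≈? a)) ≡ 1

open EnumeratesOnce

module _ {_≈_ : Rel A 0ℓ} {_≈?_ : Decidable₂ _≈_} {xs : List A} (once : EnumeratesOnce _≈?_ xs)
         {P : Pred A 0ℓ} (P? : Decidable₁ P) where

  ∑-𝟙-unique : ∀ {a} → (∀ x → P x ⇔ x ≈ a) → ∑ xs (𝟙 ∘ P?) ≡ 1
  ∑-𝟙-unique {a} P⇔≈a = trans (∑-cong xs (λ x → 𝟙-cong (P⇔≈a x) (P? x) (x ≈? a))) (exactlyOne once a)

  ∑-𝟙-fibre : {Q : Set} (Q? : Dec Q) → (∀ {x} → P x → Q) → (Q → ∃ λ a → ∀ x → P x ⇔ x ≈ a) →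
              ∑ xs (𝟙 ∘ P?) ≡ 𝟙 Q?
  ∑-𝟙-fibre Q? P⇒Q unique with Q?
  ... | yes q = ∑-𝟙-unique (proj₂ (unique q))
  ... | no ¬q = ∑-zero xs (λ x → 𝟙-no (P? x) (¬q ∘ P⇒Q))

allFin-once : ∀ {n} → EnumeratesOnce _≟_ (allFin n)
allFin-once {suc n} .exactlyOne a = begin
  ∑ (allFin (suc n)) (λ x → 𝟙 (x ≟ a))
    ≡⟨ cong (λ xs → ∑ (Fin.zero ∷ xs) (λ x → 𝟙 (x ≟ a))) (≡.sym (map-tabulate (λ x → x) Fin.suc)) ⟩
  𝟙 (Fin.zero ≟ a) + ∑ (map Fin.suc (allFin n)) (λ x → 𝟙 (x ≟ a))
    ≡⟨ cong (𝟙 (Fin.zero ≟ a) +_) (∑-map Fin.suc (allFin n) _) ⟩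
  𝟙 (Fin.zero ≟ a) + ∑ (allFin n) (λ x → 𝟙 (Fin.suc x ≟ a))
    ≡⟨ split a ⟩
  1 ∎
  where
    open ≡-Reasoning
    split : ∀ a → 𝟙 (Fin.zero ≟ a) + ∑ (allFin n) (λ x → 𝟙 (Fin.suc x ≟ a)) ≡ 1
    split Fin.zero    = cong suc (∑-zero (allFin n) (λ _ → refl))
    split (Fin.suc a) = exactlyOne allFin-once a

bools-once : EnumeratesOnce _≟B_ bools
bools-once .exactlyOne false = refl
bools-once .exactlyOne true  = refl

nothing∷just-once : {_≟ᴬ_ : Decidable₂ {A = A} _≡_} {xs : List A} → EnumeratesOnce _≟ᴬ_ xs →
                    EnumeratesOnce (Maybe.≡-dec _≟ᴬ_) (nothing ∷ map just xs)
nothing∷just-once {xs = xs} once .exactlyOne nothing  =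
  cong suc (trans (∑-map just xs _) (∑-zero xs (λ _ → refl)))
nothing∷just-once {xs = xs} once .exactlyOne (just a) = trans (∑-map just xs _) (exactlyOne once a)

funs-once : ∀ {n} {_≈_ : Rel A 0ℓ} {_≈?_ : Decidable₂ _≈_} {xs : List A} → EnumeratesOnce _≈?_ xs →
            EnumeratesOnce (Pointwiseᵛ-decidable _≈?_ {n}) (funs n xs)
funs-once {n = zero}                  once .exactlyOne a = refl
funs-once {n = suc n} {_≈_ = _≈_} {_≈?_} {xs} once .exactlyOne a = begin
  ∑ (funs (suc n) xs) (λ h → 𝟙 (h ≐? a))
    ≡⟨ ∑-concatMap _ xs _ ⟩
  ∑ xs (λ x → ∑ (map (x ∷ᶠ_) (funs n xs)) (λ h → 𝟙 (h ≐? a)))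
    ≡⟨ ∑-cong xs (λ x → ∑-map (x ∷ᶠ_) (funs n xs) _) ⟩
  ∑ xs (λ x → ∑ (funs n xs) (λ h → 𝟙 (head? x ×-dec tail? h)))
    ≡⟨ ∑-cong xs (λ x → ∑-cong (funs n xs) (λ h → 𝟙-× (head? x) (tail? h))) ⟩
  ∑ xs (λ x → ∑ (funs n xs) (λ h → 𝟙 (head? x) * 𝟙 (tail? h)))
    ≡⟨ ∑-cong xs (λ x → ≡.sym (*-distribˡ-∑ (𝟙 (head? x)) (funs n xs) (𝟙 ∘ tail?))) ⟩
  ∑ xs (λ x → 𝟙 (head? x) * ∑ (funs n xs) (𝟙 ∘ tail?))
    ≡⟨ ∑-cong xs (λ x → cong (𝟙 (head? x) *_) (exactlyOne (funs-once once) (a ∘ Fin.suc))) ⟩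
  ∑ xs (λ x → 𝟙 (head? x) * 1)
    ≡⟨ ∑-cong xs (λ x → *-identityʳ (𝟙 (head? x))) ⟩
  ∑ xs (𝟙 ∘ head?)
    ≡⟨ exactlyOne once (a Fin.zero) ⟩
  1 ∎
  where
    open ≡-Reasoning
    _≐?_ : ∀ {k} → Decidable₂ (Pointwiseᵛ _≈_ {k})
    _≐?_ = Pointwiseᵛ-decidable _≈?_
    head? : ∀ x → Dec (x ≈ a Fin.zero)
    head? x = x ≈? a Fin.zero
    tail? : ∀ h → Dec (Pointwiseᵛ _≈_ h (a ∘ Fin.suc))
    tail? h = h ≐? (a ∘ Fin.suc)

⊗-once : {_≈₁_ : Rel A 0ℓ} {_≈₂_ : Rel B 0ℓ} {_≈₁?_ : Decidable₂ _≈₁_} {_≈₂?_ : Decidable₂ _≈₂_}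
         {xs : List A} {ys : List B} → EnumeratesOnce _≈₁?_ xs → EnumeratesOnce _≈₂?_ ys →
         EnumeratesOnce (×-decidable _≈₁?_ _≈₂?_) (xs ⊗ ys)
⊗-once {_≈₁?_ = _≈₁?_} {_≈₂?_} {xs} {ys} once₁ once₂ .exactlyOne (a , b) = begin
  ∑ (xs ⊗ ys) (λ (x , y) → 𝟙 ((x ≈₁? a) ×-dec (y ≈₂? b)))
    ≡⟨ ∑-cong (xs ⊗ ys) (λ (x , y) → 𝟙-× (x ≈₁? a) (y ≈₂? b)) ⟩
  ∑ (xs ⊗ ys) (λ (x , y) → 𝟙 (x ≈₁? a) * 𝟙 (y ≈₂? b))
    ≡⟨ ∑-⊗-* xs ys _ _ ⟩
  ∑ xs (λ x → 𝟙 (x ≈₁? a)) * ∑ ys (λ y → 𝟙 (y ≈₂? b))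
    ≡⟨ cong₂ _*_ (exactlyOne once₁ a) (exactlyOne once₂ b) ⟩
  1 ∎
  where open ≡-Reasoning

-- Least elements of chains

module Least {_≤_ : Rel A 0ℓ} (≤-refl : Reflexive _≤_) (≤-trans : Transitive _≤_) (_≤?_ : Decidable₂ _≤_)
             {C : Pred A 0ℓ} (C? : Decidable₁ C) (total : ∀ {a b} → C a → C b → a ≤ b ⊎ b ≤ a) where

  private
    choose : (b w : A) → Dec (C w × w ≤ b) → A
    choose b w (yes _) = w
    choose b w (no _)  = b

    choose-C : ∀ {b w} → C b → (d : Dec (C w × w ≤ b)) → C (choose b w d)
    choose-C _  (yes (Cw , _)) = Cw
    choose-C Cb (no _)         = Cb

    choose-≤ : ∀ {b w} (d : Dec (C w × w ≤ b)) → choose b w d ≤ b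
    choose-≤ (yes (_ , w≤b)) = w≤b
    choose-≤ (no _)          = ≤-refl

    choose-least : ∀ {b w} → C b → C w → (d : Dec (C w × w ≤ b)) → choose b w d ≤ w
    choose-least _  _  (yes _) = ≤-refl
    choose-least Cb Cw (no ¬Cw×w≤b) with total Cw Cb
    ... | inj₁ w≤b = contradiction (Cw , w≤b) ¬Cw×w≤b
    ... | inj₂ b≤w = b≤w

    step : A → A → A
    step b w = choose b w (C? w ×-dec w ≤? b)

  least : A → List A → A
  least b []       = b
  least b (w ∷ ws) = least (step b w) ws

  least-C : ∀ {b} ws → C b → C (least b ws)
  least-C []       Cb = Cb
  least-C (w ∷ ws) Cb = least-C ws (choose-C Cb (C? w ×-dec w ≤? _))

  least-≤ : ∀ b ws → least b ws ≤ b
  least-≤ b []       = ≤-refl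
  least-≤ b (w ∷ ws) = ≤-trans (least-≤ (step b w) ws) (choose-≤ (C? w ×-dec w ≤? b))

  least-least : ∀ {b w} ws → C b → C w → w ∈ ws → least b ws ≤ w
  least-least {b} (w ∷ ws) Cb Cw (here refl) =
    ≤-trans (least-≤ (step b w) ws) (choose-least Cb Cw (C? w ×-dec w ≤? b))
  least-least {b} (v ∷ ws) Cb Cw (there w∈ws) =
    least-least ws (choose-C Cb (C? v ×-dec v ≤? b)) Cw w∈ws

Edge-irreflexive : (G : Graph) {x : Fin (size G)} → ¬ Edge G x x
Edge-irreflexive G {x} loop = contradiction (trans (≡.sym loop) (irrefl G x)) (λ ())

-- Factorisations through shrinking epimorphisms

module ShrinkingDecomposition (F : Graph) (le : Fin (size F) → Fin (size F) → Bool) (tree : IsTree le)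
                              (H : Graph) where

  private
    n m : ℕ
    n = size F
    m = size H

  _⊑_ : Rel (Fin n) 0ℓ
  _⊑_ = _≼_ le

  _⊑?_ : Decidable₂ _⊑_
  u ⊑? v = le u v ≟B true

  ⊑-refl : Reflexive _⊑_
  ⊑-refl = IsTree.refl tree _

  ⊑-trans : Transitive _⊑_
  ⊑-trans = IsTree.trans tree _ _ _

  ⊑-antisym : ∀ {u v} → u ⊑ v → v ⊑ u → u ≡ v
  ⊑-antisym = IsTree.antisym tree _ _

  Subgraph : Set
  Subgraph = (Fin n → Bool) × (Fin n → Fin n → Bool)

  Decomposition : Set
  Decomposition = Subgraph × (Fin n → Fin n) × (Fin n → Maybe (Fin m))

  IsDecomposition : Pred Decomposition 0ℓ
  IsDecomposition (G , f , g) = IsColSub F G × IsShrinkingEpi F le G f × IsPIHom F le H G g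

  isDecomposition? : Decidable₁ IsDecomposition
  isDecomposition? (G , f , g) = isColSub? F G ×-dec isShrinkingEpi? F le G f ×-dec isPIHom? F le H G g

  _FactorsThrough_ : (Fin n → Fin m) → Decomposition → Set
  h FactorsThrough (G , f , g) = IsDecomposition (G , f , g) × (∀ u → g (f u) ≡ just (h u))

  factorsThrough? : ∀ h → Decidable₁ (h FactorsThrough_)
  factorsThrough? h (G , f , g) =
    isDecomposition? (G , f , g) ×-dec all? (λ u → Maybe.≡-dec _≟_ (g (f u)) (just (h u)))

  maps : List (Fin n → Fin m)
  maps = funs n (allFin m)

  endomaps : List (Fin n → Fin n)
  endomaps = funs n (allFin n)

  partialMaps : List (Fin n → Maybe (Fin m))
  partialMaps = funs n (nothing ∷ map just (allFin m))

  decompositions : List Decomposition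
  decompositions = candidates F ⊗ endomaps ⊗ partialMaps

  _≈ᴰ_ : Rel Decomposition 0ℓ
  _≈ᴰ_ = Pointwise (Pointwise (Pointwiseᵛ _≡_) (Pointwiseᵛ (Pointwiseᵛ _≡_)))
                   (Pointwise (Pointwiseᵛ _≡_) (Pointwiseᵛ _≡_))

  _≈ᴰ?_ : Decidable₂ _≈ᴰ_
  _≈ᴰ?_ = ×-decidable (×-decidable (Pointwiseᵛ-decidable _≟B_) (Pointwiseᵛ-decidable (Pointwiseᵛ-decidable _≟B_)))
                      (×-decidable (Pointwiseᵛ-decidable _≟_) (Pointwiseᵛ-decidable (Maybe.≡-dec _≟_)))

  decompositions-once : EnumeratesOnce _≈ᴰ?_ decompositions
  decompositions-once = ⊗-once (⊗-once (funs-once bools-once) (funs-once (funs-once bools-once)))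
                               (⊗-once (funs-once allFin-once) (funs-once (nothing∷just-once allFin-once)))

  factorsThrough⇒isHom : ∀ {h} d → h FactorsThrough d → IsHom F H h
  factorsThrough⇒isHom {h} (G , f , g) ((_ , (inS , colF , edgeF , _) , (_ , inside , edgesH , _)) , g∘f≡h) =
    colours , λ u v e → edgesH _ _ _ _ (edgeF u v e) (g∘f≡h u) (g∘f≡h v)
    where
      colours : ∀ u → col H (h u) ≡ col F u
      colours u with inside (f u) (inS u)
      ... | x , g∘f≡x , col-x =
        trans (cong (col H) (just-injective (trans (≡.sym (g∘f≡h u)) g∘f≡x))) (trans col-x (colF u))

  ∑-composites : ∀ d → ∑ maps (λ h → 𝟙 (factorsThrough? h d)) ≡ 𝟙 (isDecomposition? d)
  ∑-composites d@(G , f , g) =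
    ∑-𝟙-fibre (funs-once allFin-once) (λ h → factorsThrough? h d) (isDecomposition? d) proj₁ determined
    where
      determined : IsDecomposition d → ∃ λ h₀ → ∀ h → h FactorsThrough d ⇔ Pointwiseᵛ _≡_ h h₀
      determined isD@(_ , (inS , _) , (_ , inside , _)) = h₀ , λ h →
        mk⇔ (λ (_ , g∘f≡h) u → just-injective (trans (≡.sym (g∘f≡h u)) (g∘f≡h₀ u)))
            (λ h≗h₀ → isD , λ u → trans (g∘f≡h₀ u) (cong just (≡.sym (h≗h₀ u))))
        where
          h₀ : Fin n → Fin m
          h₀ u = proj₁ (inside (f u) (inS u))
          g∘f≡h₀ : ∀ u → g (f u) ≡ just (h₀ u)
          g∘f≡h₀ u = proj₁ (proj₂ (inside (f u) (inS u)))

  module Canonical (h : Fin n → Fin m) where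

    private
      Below : Fin n → Pred (Fin n) 0ℓ
      Below u v = v ⊑ u × h v ≡ h u

      below? : ∀ u → Decidable₁ (Below u)
      below? u v = (v ⊑? u) ×-dec (h v ≟ h u)

      below-total : ∀ u {v w} → Below u v → Below u w → v ⊑ w ⊎ w ⊑ v
      below-total u (v⊑u , _) (w⊑u , _) = IsTree.downChain tree u _ _ v⊑u w⊑u

      module LeastBelow (u : Fin n) = Least ⊑-refl ⊑-trans _⊑?_ (below? u) (below-total u)

    root : Fin n → Fin n
    root u = LeastBelow.least u u (allFin n)

    root-⊑ : ∀ u → root u ⊑ u
    root-⊑ u = proj₁ (LeastBelow.least-C u (allFin n) (⊑-refl , refl))

    root-h : ∀ u → h (root u) ≡ h u
    root-h u = proj₂ (LeastBelow.least-C u (allFin n) (⊑-refl , refl))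

    root-least : ∀ {u v} → v ⊑ u → h v ≡ h u → root u ⊑ v
    root-least {u} {v} v⊑u hv≡hu =
      LeastBelow.least-least u (allFin n) (⊑-refl , refl) (v⊑u , hv≡hu) (∈-allFin v)

    root-idem : ∀ u → root (root u) ≡ root u
    root-idem u = ⊑-antisym (root-⊑ (root u))
      (root-least (⊑-trans (root-⊑ (root u)) (root-⊑ u)) (trans (root-h (root u)) (root-h u)))

    Linked : Fin n → Fin n → Set
    Linked w w′ = ∃ λ a → ∃ λ b → Edge F a b × root a ≡ w × root b ≡ w′

    linked? : ∀ w w′ → Dec (Linked w w′)
    linked? w w′ = any? λ a → any? λ b → (adj F a b ≟B true) ×-dec (root a ≟ w) ×-dec (root b ≟ w′)

    S₀ : Fin n → Bool
    S₀ w = does (root w ≟ w)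

    E₀ : Fin n → Fin n → Bool
    E₀ w w′ = does (linked? w w′)

    g₀ : Fin n → Maybe (Fin m)
    g₀ w = if S₀ w then just (h w) else nothing

    canonical : Decomposition
    canonical = (S₀ , E₀) , root , g₀

    S₀-root : ∀ u → S₀ (root u) ≡ true
    S₀-root u = dec-true (root (root u) ≟ root u) (root-idem u)

    S₀⇒root : ∀ {w} → S₀ w ≡ true → root w ≡ w
    S₀⇒root {w} = does-true⇒ (root w ≟ w)

    E₀-edge : ∀ {a b} → Edge F a b → E₀ (root a) (root b) ≡ true
    E₀-edge {a} {b} e = dec-true (linked? (root a) (root b)) (a , b , e , refl , refl)

    E₀⇒linked : ∀ {w w′} → E₀ w w′ ≡ true → Linked w w′
    E₀⇒linked {w} {w′} = does-true⇒ (linked? w w′)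

    E₀⇒S₀ : ∀ {w w′} → E₀ w w′ ≡ true → S₀ w ≡ true
    E₀⇒S₀ e with E₀⇒linked e
    ... | a , _ , _ , refl , _ = S₀-root a

    E₀-sym : ∀ w w′ → E₀ w w′ ≡ E₀ w′ w
    E₀-sym w w′ = does-⇔ (mk⇔ swap swap) (linked? w w′) (linked? w′ w)
      where
        swap : ∀ {x y} → Linked x y → Linked y x
        swap (a , b , e , p , q) = b , a , trans (Graph.sym F b a) e , q , p

    g₀-S₀ : ∀ {w} → S₀ w ≡ true → g₀ w ≡ just (h w)
    g₀-S₀ {w} S₀w = cong (λ b → if b then just (h w) else nothing) S₀w

    g₀-¬S₀ : ∀ {w} → S₀ w ≡ false → g₀ w ≡ nothing
    g₀-¬S₀ {w} ¬S₀w = cong (λ b → if b then just (h w) else nothing) ¬S₀w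

    roots-pastInjective : ∀ {u v} → S₀ u ≡ true → S₀ v ≡ true → _≺_ le u v → h u ≢ h v
    roots-pastInjective {u} {v} _ S₀v (u⊑v , u≢v) hu≡hv =
      u≢v (⊑-antisym u⊑v (subst (_⊑ u) (S₀⇒root S₀v) (root-least u⊑v hu≡hv)))

    module _ (isHom : IsHom F H h) where

      root-col : ∀ u → col F (root u) ≡ col F u
      root-col u = trans (≡.sym (proj₁ isHom (root u))) (trans (cong (col H) (root-h u)) (proj₁ isHom u))

      E₀-edgeH : ∀ {w w′} → E₀ w w′ ≡ true → Edge H (h w) (h w′)
      E₀-edgeH e with E₀⇒linked e
      ... | a , b , eab , refl , refl =
        subst₂ (Edge H) (≡.sym (root-h a)) (≡.sym (root-h b)) (proj₂ isHom a b eab)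

      E₀-irrefl : ∀ w → E₀ w w ≡ false
      E₀-irrefl w = ¬-not (λ E₀ww → Edge-irreflexive H (E₀-edgeH E₀ww))

    factor-h : ∀ {S E f g} → h FactorsThrough ((S , E) , f , g) → ∀ u → h (f u) ≡ h u
    factor-h {f = f} {g} ((_ , (_ , _ , _ , _ , _ , _ , idem) , _) , g∘f≡h) u =
      just-injective (trans (≡.sym (g∘f≡h (f u))) (trans (cong g (idem u)) (g∘f≡h u)))

    root⊑factor : ∀ {S E f g} → h FactorsThrough ((S , E) , f , g) → ∀ u → root u ⊑ f u
    root⊑factor fac@((_ , (_ , _ , _ , _ , _ , shrink , _) , _) , _) u = root-least (shrink u) (factor-h fac u)

    -- f (root u) ⊑ root u ⊑ f u are vertices of G with the same g-value, so past-injectivity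
    -- identifies them.
    factor≗root : ∀ {S E f g} → h FactorsThrough ((S , E) , f , g) → ∀ u → f u ≡ root u
    factor≗root {f = f} fac@((_ , (inS , _ , _ , _ , _ , shrink , _) , (_ , _ , _ , pastInj)) , g∘f≡h) u
      with f (root u) ≟ f u
    ... | yes same  = ⊑-antisym (subst (_⊑ root u) same (shrink (root u))) (root⊑factor fac u)
    ... | no differ = contradiction
      (trans (g∘f≡h (root u)) (trans (cong just (root-h u)) (≡.sym (g∘f≡h u))))
      (pastInj _ _ (inS (root u)) (inS u) (⊑-trans (shrink (root u)) (root⊑factor fac u) , differ))

    factor-fixes : ∀ {S E f g} → h FactorsThrough ((S , E) , f , g) → ∀ {w} → S w ≡ true → f w ≡ w
    factor-fixes {f = f} ((_ , (_ , _ , _ , onto , _ , _ , idem) , _) , _) Sw with onto _ Sw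
    ... | a , refl = idem a

    factor-S≗S₀ : ∀ {S E f g} → h FactorsThrough ((S , E) , f , g) → ∀ w → S w ≡ S₀ w
    factor-S≗S₀ {S} fac@((_ , (inS , _) , _) , _) w = ≡-does (S w) (root w ≟ w) (mk⇔
      (λ Sw → trans (≡.sym (factor≗root fac w)) (factor-fixes fac Sw))
      (λ root-w≡w → subst (λ x → S x ≡ true) (trans (factor≗root fac w) root-w≡w) (inS w)))

    factor-E≗E₀ : ∀ {S E f g} → h FactorsThrough ((S , E) , f , g) → ∀ w w′ → E w w′ ≡ E₀ w w′
    factor-E≗E₀ {E = E} fac@((_ , (_ , _ , edge , _ , edgeOnto , _) , _) , _) w w′ =
      ≡-does (E w w′) (linked? w w′) (mk⇔
        (λ Eww′ → let (a , b , e , p , q) = edgeOnto w w′ Eww′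
                  in a , b , e , trans (≡.sym (factor≗root fac a)) p , trans (≡.sym (factor≗root fac b)) q)
        (λ (a , b , e , p , q) → subst₂ (λ x y → E x y ≡ true)
                                   (trans (factor≗root fac a) p) (trans (factor≗root fac b) q) (edge a b e)))

    factor-g≗g₀ : ∀ {S E f g} → h FactorsThrough ((S , E) , f , g) → ∀ w → g w ≡ g₀ w
    factor-g≗g₀ {S} {g = g} fac@((_ , _ , outside , _) , g∘f≡h) w with S w in Sw
    ... | true  = trans (trans (cong g (≡.sym (factor-fixes fac Sw))) (g∘f≡h w))
                        (≡.sym (g₀-S₀ (trans (≡.sym (factor-S≗S₀ fac w)) Sw)))
    ... | false = trans (outside w Sw) (≡.sym (g₀-¬S₀ (trans (≡.sym (factor-S≗S₀ fac w)) Sw)))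

    factorsThrough⇒≈canonical : ∀ d → h FactorsThrough d → d ≈ᴰ canonical
    factorsThrough⇒≈canonical ((S , E) , f , g) fac =
      (factor-S≗S₀ fac , factor-E≗E₀ fac) , factor≗root fac , factor-g≗g₀ fac

    module AgreeingWithCanonical (isHom : IsHom F H h)
      {S : Fin n → Bool} {E : Fin n → Fin n → Bool} {f : Fin n → Fin n} {g : Fin n → Maybe (Fin m)}
      (S≗S₀ : ∀ w → S w ≡ S₀ w) (E≗E₀ : ∀ w w′ → E w w′ ≡ E₀ w w′)
      (f≗root : ∀ u → f u ≡ root u) (g≗g₀ : ∀ w → g w ≡ g₀ w) where

      S-true : ∀ {w} → S₀ w ≡ true → S w ≡ true
      S-true {w} = trans (S≗S₀ w)

      S₀-true : ∀ {w} → S w ≡ true → S₀ w ≡ true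
      S₀-true {w} = trans (≡.sym (S≗S₀ w))

      E-true : ∀ {w w′} → E₀ w w′ ≡ true → E w w′ ≡ true
      E-true {w} {w′} = trans (E≗E₀ w w′)

      E₀-true : ∀ {w w′} → E w w′ ≡ true → E₀ w w′ ≡ true
      E₀-true {w} {w′} = trans (≡.sym (E≗E₀ w w′))

      g-S : ∀ {w} → S w ≡ true → g w ≡ just (h w)
      g-S {w} Sw = trans (g≗g₀ w) (g₀-S₀ (S₀-true Sw))

      colSub : IsColSub F (S , E)
      colSub = (λ w w′ e → S-true (E₀⇒S₀ (E₀-true e)))
             , (λ w w′ → trans (E≗E₀ w w′) (trans (E₀-sym w w′) (≡.sym (E≗E₀ w′ w))))
             , (λ w → trans (E≗E₀ w w) (E₀-irrefl isHom w))

      shrinkingEpi : IsShrinkingEpi F le (S , E) f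
      shrinkingEpi =
          (λ u → subst (λ x → S x ≡ true) (≡.sym (f≗root u)) (S-true (S₀-root u)))
        , (λ u → trans (cong (col F) (f≗root u)) (root-col isHom u))
        , (λ u v e → subst₂ (λ x y → E x y ≡ true) (≡.sym (f≗root u)) (≡.sym (f≗root v)) (E-true (E₀-edge e)))
        , (λ w Sw → w , trans (f≗root w) (S₀⇒root (S₀-true Sw)))
        , (λ w w′ e → let (a , b , eab , p , q) = E₀⇒linked (E₀-true e)
                      in a , b , eab , trans (f≗root a) p , trans (f≗root b) q)
        , (λ u → subst (_⊑ u) (≡.sym (f≗root u)) (root-⊑ u))
        , (λ u → trans (f≗root (f u)) (trans (cong root (f≗root u)) (trans (root-idem u) (≡.sym (f≗root u)))))

      piHom : IsPIHom F le H (S , E) g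
      piHom =
          (λ w ¬Sw → trans (g≗g₀ w) (g₀-¬S₀ (trans (≡.sym (S≗S₀ w)) ¬Sw)))
        , (λ w Sw → h w , g-S Sw , proj₁ isHom w)
        , (λ w w′ x y e gw gw′ →
             let Sw  = S-true (E₀⇒S₀ (E₀-true e))
                 Sw′ = S-true (E₀⇒S₀ (trans (E₀-sym w′ w) (E₀-true e)))
             in subst₂ (Edge H) (just-injective (trans (≡.sym (g-S Sw)) gw))
                                (just-injective (trans (≡.sym (g-S Sw′)) gw′))
                                (E₀-edgeH isHom (E₀-true e)))
        , (λ w w′ Sw Sw′ w≺w′ gw≡gw′ → roots-pastInjective (S₀-true Sw) (S₀-true Sw′) w≺w′
             (just-injective (trans (≡.sym (g-S Sw)) (trans gw≡gw′ (g-S Sw′)))))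

      factors : ∀ u → g (f u) ≡ just (h u)
      factors u = trans (cong g (f≗root u)) (trans (g-S (S-true (S₀-root u))) (cong just (root-h u)))

    ≈canonical⇒factorsThrough : IsHom F H h → ∀ d → d ≈ᴰ canonical → h FactorsThrough d
    ≈canonical⇒factorsThrough isHom ((S , E) , f , g) ((S≗S₀ , E≗E₀) , f≗root , g≗g₀) =
      (colSub , shrinkingEpi , piHom) , factors
      where open AgreeingWithCanonical isHom S≗S₀ E≗E₀ f≗root g≗g₀

  ∑-factorisations : ∀ h → ∑ decompositions (λ d → 𝟙 (factorsThrough? h d)) ≡ 𝟙 (isHom? F H h)
  ∑-factorisations h =
    ∑-𝟙-fibre decompositions-once (factorsThrough? h) (isHom? F H h) (factorsThrough⇒isHom _)
      λ isHom → canonical , λ d → mk⇔ (factorsThrough⇒≈canonical d) (≈canonical⇒factorsThrough isHom d)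
    where open Canonical h

  ∑-decompositionsOnto : ∀ G → ∑ (endomaps ⊗ partialMaps) (λ (f , g) → 𝟙 (isDecomposition? (G , f , g)))
                             ≡ 𝟙 (isColSub? F G) * (s-epi F le G * pi-hom F le H G)
  ∑-decompositionsOnto G = begin
      ∑ (endomaps ⊗ partialMaps) (λ (f , g) → 𝟙 (colSub? ×-dec epi? f ×-dec pi? g))
    ≡⟨ ∑-cong (endomaps ⊗ partialMaps) (λ (f , g) →
         trans (𝟙-× colSub? (epi? f ×-dec pi? g)) (cong (𝟙 colSub? *_) (𝟙-× (epi? f) (pi? g)))) ⟩
      ∑ (endomaps ⊗ partialMaps) (λ (f , g) → 𝟙 colSub? * (𝟙 (epi? f) * 𝟙 (pi? g)))
    ≡⟨ ≡.sym (*-distribˡ-∑ (𝟙 colSub?) (endomaps ⊗ partialMaps) (λ (f , g) → 𝟙 (epi? f) * 𝟙 (pi? g))) ⟩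
      𝟙 colSub? * ∑ (endomaps ⊗ partialMaps) (λ (f , g) → 𝟙 (epi? f) * 𝟙 (pi? g))
    ≡⟨ cong (𝟙 colSub? *_) (∑-⊗-* endomaps partialMaps (𝟙 ∘ epi?) (𝟙 ∘ pi?)) ⟩
      𝟙 colSub? * (∑ endomaps (𝟙 ∘ epi?) * ∑ partialMaps (𝟙 ∘ pi?))
    ≡⟨ cong (𝟙 colSub? *_) (≡.sym (cong₂ _*_ (count≡∑𝟙 epi? endomaps) (count≡∑𝟙 pi? partialMaps))) ⟩
      𝟙 colSub? * (s-epi F le G * pi-hom F le H G)
    ∎
    where
      open ≡-Reasoning
      colSub? : Dec (IsColSub F G)
      colSub? = isColSub? F G
      epi? : Decidable₁ (IsShrinkingEpi F le G)
      epi? = isShrinkingEpi? F le G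
      pi? : Decidable₁ (IsPIHom F le H G)
      pi? = isPIHom? F le H G

  ∑-isDecomposition : ∑ decompositions (𝟙 ∘ isDecomposition?)
                    ≡ sum (map (λ G → s-epi F le G * pi-hom F le H G) (colSubs F))
  ∑-isDecomposition = begin
      ∑ decompositions (𝟙 ∘ isDecomposition?)
    ≡⟨ ∑-⊗ (candidates F) _ _ ⟩
      ∑ (candidates F) (λ G → ∑ (endomaps ⊗ partialMaps) (λ (f , g) → 𝟙 (isDecomposition? (G , f , g))))
    ≡⟨ ∑-cong (candidates F) ∑-decompositionsOnto ⟩
      ∑ (candidates F) (λ G → 𝟙 (isColSub? F G) * (s-epi F le G * pi-hom F le H G))
    ≡⟨ ≡.sym (∑-filter (isColSub? F) (candidates F) _) ⟩
      sum (map (λ G → s-epi F le G * pi-hom F le H G) (colSubs F))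
    ∎
    where open ≡-Reasoning

corollary8 : (k : ℕ) (F : Graph) (le : Fin (size F) → Fin (size F) → Bool)
    → IsEliminationTree k F le → (H : Graph)
    → hom F H ≡ sum (map (λ G → s-epi F le G * pi-hom F le H G) (colSubs F))
corollary8 k F le et H = begin
    hom F H
  ≡⟨ count≡∑𝟙 (isHom? F H) maps ⟩
    ∑ maps (𝟙 ∘ isHom? F H)
  ≡⟨ ∑-cong maps (λ h → ≡.sym (∑-factorisations h)) ⟩
    ∑ maps (λ h → ∑ decompositions (λ d → 𝟙 (factorsThrough? h d)))
  ≡⟨ ∑-swap maps decompositions _ ⟩
    ∑ decompositions (λ d → ∑ maps (λ h → 𝟙 (factorsThrough? h d)))
  ≡⟨ ∑-cong decompositions ∑-composites ⟩
    ∑ decompositions (𝟙 ∘ isDecomposition?)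
  ≡⟨ ∑-isDecomposition ⟩
    sum (map (λ G → s-epi F le G * pi-hom F le H G) (colSubs F))
  ∎
  where
    open ≡-Reasoning
    open ShrinkingDecomposition F le (IsEliminationTree.tree et) H
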